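{- The satisfiability problem for $\mathrm{FO}[\sim]$ is decidable. Moreover, if a sentence $\varphi\in\mathrm{FO}_A[\sim]$ has a model $(\mathbb{P},w)$ with $w$ an infinite execution, then it also has a model $(\mathbb{P}',w')$ with $w'$ a finite execution.
   Context: Process types: $\mathbb{T}=\{s,e,se\}$. A process triple $\mathbb{P}=(\mathbb{P}_s,\mathbb{P}_e,\mathbb{P}_{se})$ consists of pairwise disjoint finite sets; $A=A_s\uplus A_e$ is a finite alphabet; events are $\Sigma_s=A_s\times(\mathbb{P}_s\cup\mathbb{P}_{se})$, $\Sigma_e=A_e\times(\mathbb{P}_e\cup\mathbb{P}_{se})$, $\Sigma=\Sigma_s\cup\Sigma_e$; an execution is $w\in\Sigma^*\cup\Sigma^\omega$. The logic $\mathrm{FO}_A[\sim]$ has atomic formulas $\theta(x)$ ($\theta\in\mathbb{T}$), $a(x)$ ($a\in A$), $x=y$, $x\sim y$, closed under $\neg,\vee,\exists$, evaluated over the structure with universe $\mathbb{P}\uplus\mathrm{Pos}(w)$ where $\theta$ denotes $\mathbb{P}_\theta$, $a$ denotes positions whose event has action $a$, and $\sim$ is the least equivalence relation relating a process to the positions it executes and positions executed by the same process; $(\mathbb{P},w)$ is a model of $\varphi$ if $(\mathbb{P},w)\models\varphi$. A $\mathbb{P}$-strategy is $f:\Sigma^*\to\Sigma_s\cup\{\varepsilon\}$; an execution $\sigma_1\sigma_2\dots$ is $f$-compatible if $f(\sigma_1\dots\sigma_{i-1})=\sigma_i$ whenever $\sigma_i\in\Sigma_s$, and $f$-fair if finite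 executions $w$ satisfy $f(w)=\varepsilon$ and infinite ones in which $f$ is non-$\varepsilon$ on infinitely many prefixes contain infinitely many $\Sigma_s$-events; $f$ is $\mathbb{P}$-winning for $\varphi$ if all $f$-compatible $f$-fair executions satisfy $\varphi$. $\mathrm{Win}(\varphi)$ is the set of $(k_s,k_e,k_{se})$ such that some $\mathbb{P}$ with $|\mathbb{P}_\theta|=k_\theta$ admits a $\mathbb{P}$-winning strategy for $\varphi$. The satisfiability problem for $\mathrm{FO}[\sim]$ asks, given $A=A_s\uplus A_e$ and a sentence $\varphi\in\mathrm{FO}_A[\sim]$, whether $\mathrm{Win}(\varphi)\cap(\mathbb{N}\times\{0\}\times\{0\})\ne\emptyset$. -}

module Defs where

open import Data.Nat using (ℕ; suc; _≤_)
open import Data.Fin using (Fin; zero; suc; toℕ)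
open import Data.List using (List; length; lookup; take; map; upTo)
open import Data.Maybe using (Maybe; just; nothing; Is-just)
open import Data.Product using (Σ; ∃; _×_; _,_)
open import Data.Sum using (_⊎_; inj₁; inj₂)
open import Relation.Nullary using (¬_)
open import Data.Empty using (⊥)
open import Relation.Binary.PropositionalEquality using (_≡_)
open import Relation.Binary.Construct.Closure.Equivalence using (EqClosure)

data PType : Set where
  s e se : PType

Act : ℕ → ℕ → Set
Act ns ne = Fin ns ⊎ Fin ne

-- Formulas of FO_A[∼] with (de Bruijn) variables in Fin n;
-- the quantifier ∃' binds variable zero.
data Formula (ns ne : ℕ) (n : ℕ) : Set where
  typ  : PType → Fin n → Formula ns ne n
  act  : Act ns ne → Fin n → Formula ns ne n
  eq   : Fin n → Fin n → Formula ns ne n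
  sim  : Fin n → Fin n → Formula ns ne n
  neg  : Formula ns ne n → Formula ns ne n
  _∨'_ : Formula ns ne n → Formula ns ne n → Formula ns ne n
  ∃'   : Formula ns ne (suc n) → Formula ns ne n

Sentence : ℕ → ℕ → Set
Sentence ns ne = Formula ns ne 0

module Exec (ns ne ks ke kse : ℕ) where

  Proc : Set
  Proc = Fin ks ⊎ (Fin ke ⊎ Fin kse)

  procType : Proc → PType
  procType (inj₁ _) = s
  procType (inj₂ (inj₁ _)) = e
  procType (inj₂ (inj₂ _)) = se

  SysEvent : Set
  SysEvent = Fin ns × (Fin ks ⊎ Fin kse)

  data Event : Set where
    sev : Fin ns → Fin ks ⊎ Fin kse → Event
    eev : Fin ne → Fin ke ⊎ Fin kse → Event

  proc : Event → Proc
  proc (sev _ (inj₁ p)) = inj₁ p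
  proc (sev _ (inj₂ p)) = inj₂ (inj₂ p)
  proc (eev _ (inj₁ p)) = inj₂ (inj₁ p)
  proc (eev _ (inj₂ p)) = inj₂ (inj₂ p)

  action : Event → Act ns ne
  action (sev a _) = inj₁ a
  action (eev a _) = inj₂ a

  toSys : Event → Maybe SysEvent
  toSys (sev a p) = just (a , p)
  toSys (eev _ _) = nothing

  data Execution : Set where
    fin : List Event → Execution
    inf : (ℕ → Event) → Execution

  Pos : Execution → Set
  Pos (fin l) = Fin (length l)
  Pos (inf g) = ℕ

  evAt : (w : Execution) → Pos w → Event
  evAt (fin l) i = lookup l i
  evAt (inf g) i = g i

  infPrefix : (ℕ → Event) → ℕ → List Event
  infPrefix g m = map g (upTo m)

  prefixBefore : (w : Execution) → Pos w → List Event
  prefixBefore (fin l) i = take (toℕ i) l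
  prefixBefore (inf g) i = infPrefix g i

  Univ : Execution → Set
  Univ w = Proc ⊎ Pos w

  data Gen (w : Execution) : Univ w → Univ w → Set where
    pe : (i : Pos w) → Gen w (inj₁ (proc (evAt w i))) (inj₂ i)
    ee : (i j : Pos w) → proc (evAt w i) ≡ proc (evAt w j) → Gen w (inj₂ i) (inj₂ j)

  HasType : (w : Execution) → Univ w → PType → Set
  HasType w (inj₁ p) θ = procType p ≡ θ
  HasType w (inj₂ _) θ = ⊥

  HasAct : (w : Execution) → Univ w → Act ns ne → Set
  HasAct w (inj₁ _) a = ⊥
  HasAct w (inj₂ i) a = action (evAt w i) ≡ a

  extend : {n : ℕ} {X : Set} → X → (Fin n → X) → Fin (suc n) → X
  extend u ρ zero = u
  extend u ρ (suc i) = ρ i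

  Sat : (w : Execution) {n : ℕ} → Formula ns ne n → (Fin n → Univ w) → Set
  Sat w (typ θ x) ρ = HasType w (ρ x) θ
  Sat w (act a x) ρ = HasAct w (ρ x) a
  Sat w (eq x y) ρ = ρ x ≡ ρ y
  Sat w (sim x y) ρ = EqClosure (Gen w) (ρ x) (ρ y)
  Sat w (neg φ) ρ = ¬ Sat w φ ρ
  Sat w (φ ∨' ψ) ρ = Sat w φ ρ ⊎ Sat w ψ ρ
  Sat w (∃' φ) ρ = Σ (Univ w) λ u → Sat w φ (extend u ρ)

  Models : Execution → Sentence ns ne → Set
  Models w φ = Sat w φ (λ ())

  -- ℙ-strategies f : Σ* → Σ_s ∪ {ε}   (nothing = ε)
  Strategy : Set
  Strategy = List Event → Maybe SysEvent

  Compatible : Strategy → Execution → Set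
  Compatible f w = (i : Pos w) (σ : SysEvent) →
    toSys (evAt w i) ≡ just σ → f (prefixBefore w i) ≡ just σ

  Fair : Strategy → Execution → Set
  Fair f (fin l) = f l ≡ nothing
  Fair f (inf g) =
    ((n : ℕ) → ∃ λ m → n ≤ m × Is-just (f (infPrefix g m))) →
    ((n : ℕ) → ∃ λ m → n ≤ m × Is-just (toSys (g m)))

  Winning : Strategy → Sentence ns ne → Set
  Winning f φ = (w : Execution) → Compatible f w → Fair f w → Models w φ

Win : (ns ne : ℕ) → Sentence ns ne → ℕ → ℕ → ℕ → Set
Win ns ne φ ks ke kse = Σ (Exec.Strategy ns ne ks ke kse) λ f → Exec.Winning ns ne ks ke kse f φ

SatProblem : (ns ne : ℕ) → Sentence ns ne → Set
SatProblem ns ne φ = ∃ λ ks → Win ns ne φ ks 0 0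

-- A sentence of quantifier rank K cannot count beyond K.  If an event occurs
-- at least K times, discarding its further occurrences preserves every sentence
-- of rank at most K: when the Spoiler pebbles a discarded position while fewer
-- than K positions are pebbled, the involution exchanging it with an unpebbled
-- kept occurrence of the same event moves it back into the kept part.  So every
-- model, infinite ones included, yields a model in which each event occurs at
-- most K times, which is finite.  With system processes only, the same argument
-- applied to whole processes, grouped by their profile of action counts, also
-- bounds the number of processes.  The play of a winning strategy is a model and
-- the strategy replaying a finite model wins, so satisfiability becomes a bounded
-- search for finite models.  Choosing the kept occurrences is classical and done
-- under ¬¬; the bounded search is decidable, which removes the double negation.

module Submission where

open import Defs
open import Level using (0ℓ)
open import Data.Empty using (⊥; ⊥-elim)
open import Data.Unit using (⊤; tt)
open import Data.Nat using (ℕ; zero; suc; _+_; _*_; _≤_; _<_; z≤n; s≤s; _⊔_)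
import Data.Nat.Properties as ℕₚ
open import Data.Fin as Fin using (Fin; zero; suc; toℕ; cast)
import Data.Fin.Properties as Finₚ
open import Data.Product using (Σ; ∃; _×_; _,_; proj₁; proj₂)
open import Data.Product.Function.Dependent.Propositional using (Σ-↔)
open import Data.Product.Function.NonDependent.Propositional using (_×-↔_)
open import Data.Sum as Sum using (_⊎_; inj₁; inj₂)
import Data.Sum.Properties as ⊎ₚ
open import Data.Sum.Function.Propositional using (_⊎-↔_)
open import Data.Maybe using (Maybe; just; nothing)
import Data.Maybe.Relation.Unary.Any as Maybe
open import Data.List as List using (List; []; _∷_; _++_; _∷ʳ_; length; lookup)
import Data.List.Properties as Listₚ
open import Data.Vec as Vec using (Vec; []; _∷_)
import Data.Vec.Properties as Vecₚ
import Data.Vec.Functional as Vector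
open import Function using (_∘_; id; case_of_)
open import Function.Bundles using (_↔_; Inverse; mk↔ₛ′; _⇔_; mk⇔; Equivalence)
open import Function.Definitions using (Injective)
open import Function.Properties.Inverse using (↔-refl; ↔-sym; ↔-trans)
open import Effect.Monad using (RawMonad)
open import Relation.Binary.Definitions using (DecidableEquality)
open import Relation.Binary.PropositionalEquality hiding ([_])
open import Relation.Binary.Construct.Closure.Equivalence using (EqClosure)
import Relation.Binary.Construct.Closure.Equivalence as Closure
open import Relation.Nullary using (¬_; ¬?; Dec; yes; no)
open import Relation.Nullary.Decidable using (map′; ¬¬-excluded-middle; _⊎-dec_; decidable-stable)
open import Relation.Nullary.Negation using (¬¬-Monad)
open import Relation.Nullary.Negation.Core using () renaming (DoubleNegation to ¬¬_)

open Equivalence using (to; from)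
open RawMonad (¬¬-Monad {0ℓ}) using (return; _>>=_; rawApplicative)

record Finite (A : Set) : Set where
  field
    size : ℕ
    enum : A ↔ Fin size

  index : A → Fin size
  index = Inverse.to enum

  element : Fin size → A
  element = Inverse.from enum

  element-index : ∀ a → element (index a) ≡ a
  element-index = Inverse.strictlyInverseʳ enum

  index-element : ∀ i → index (element i) ≡ i
  index-element = Inverse.strictlyInverseˡ enum

  index-injective : Injective _≡_ _≡_ index
  index-injective {a} {b} i≡j = trans (sym (element-index a)) (trans (cong element i≡j) (element-index b))

  _≟_ : DecidableEquality A
  a ≟ b = map′ index-injective (cong index) (index a Finₚ.≟ index b)

  any? : {P : A → Set} → (∀ a → Dec (P a)) → Dec (∃ P)
  any? {P} P? = map′ (λ (i , p) → element i , p)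
                     (λ (a , p) → index a , subst P (sym (element-index a)) p)
                     (Finₚ.any? (P? ∘ element))

open Finite using (size)

finite-↔ : ∀ {A B} → A ↔ B → Finite B → Finite A
finite-↔ A↔B fb = record { size = size fb ; enum = ↔-trans A↔B (Finite.enum fb) }

finite-Fin : ∀ {n} → Finite (Fin n)
finite-Fin {n} = record { size = n ; enum = ↔-refl }

finite-⊎ : ∀ {A B} → Finite A → Finite B → Finite (A ⊎ B)
finite-⊎ fa fb = record
  { size = size fa + size fb
  ; enum = ↔-trans (Finite.enum fa ⊎-↔ Finite.enum fb) (↔-sym Finₚ.+↔⊎) }

finite-× : ∀ {A B} → Finite A → Finite B → Finite (A × B)
finite-× fa fb = record
  { size = size fa * size fb
  ; enum = ↔-trans (Finite.enum fa ×-↔ Finite.enum fb) (↔-sym Finₚ.*↔×) }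

Vec-suc↔× : ∀ {A : Set} {n} → Vec A (suc n) ↔ (A × Vec A n)
Vec-suc↔× = mk↔ₛ′ (λ { (x ∷ xs) → x , xs }) (λ (x , xs) → x ∷ xs) (λ _ → refl) (λ { (x ∷ xs) → refl })

finite-Vec : ∀ {A} n → Finite A → Finite (Vec A n)
finite-Vec zero fa = record
  { size = 1 ; enum = mk↔ₛ′ (λ _ → zero) (λ _ → []) (λ { zero → refl }) (λ { [] → refl }) }
finite-Vec (suc n) fa = finite-↔ Vec-suc↔× (finite-× fa (finite-Vec n fa))

∑ : ∀ n → (Fin n → ℕ) → ℕ
∑ zero c = 0
∑ (suc n) c = c zero + ∑ n (c ∘ suc)

∑-≤ : ∀ n (c : Fin n → ℕ) {K} → (∀ i → c i ≤ K) → ∑ n c ≤ n * K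
∑-≤ zero c bound = z≤n
∑-≤ (suc n) c bound = ℕₚ.+-mono-≤ (bound zero) (∑-≤ n (c ∘ suc) (bound ∘ suc))

Σ-Fin-suc↔ : ∀ {n} {P : Fin (suc n) → Set} → Σ (Fin (suc n)) P ↔ (P zero ⊎ Σ (Fin n) (P ∘ suc))
Σ-Fin-suc↔ = mk↔ₛ′
  (λ { (zero , x) → inj₁ x ; (suc i , x) → inj₂ (i , x) })
  (λ { (inj₁ x) → zero , x ; (inj₂ (i , x)) → suc i , x })
  (λ { (inj₁ x) → refl ; (inj₂ (i , x)) → refl })
  (λ { (zero , x) → refl ; (suc i , x) → refl })

Σ-Fin↔Fin-∑ : ∀ n (c : Fin n → ℕ) → Σ (Fin n) (Fin ∘ c) ↔ Fin (∑ n c)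
Σ-Fin↔Fin-∑ zero c = mk↔ₛ′ (λ { (() , _) }) (λ ()) (λ ()) (λ { (() , _) })
Σ-Fin↔Fin-∑ (suc n) c =
  ↔-trans Σ-Fin-suc↔ (↔-trans (↔-refl ⊎-↔ Σ-Fin↔Fin-∑ n (c ∘ suc)) (↔-sym Finₚ.+↔⊎))

finite-Σ-Fin : ∀ {A} → Finite A → (c : A → ℕ) → Finite (Σ A (Fin ∘ c))
finite-Σ-Fin fa c = record
  { size = ∑ (size fa) (c ∘ element)
  ; enum = ↔-trans (Σ-↔ enum Fin-c↔) (Σ-Fin↔Fin-∑ (size fa) (c ∘ element)) }
  where
    open Finite fa using (enum; element; index; element-index)
    Fin-c↔ : ∀ {a} → Fin (c a) ↔ Fin (c (element (index a)))
    Fin-c↔ {a} = subst (λ b → Fin (c a) ↔ Fin (c b)) (sym (element-index a)) ↔-refl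

size-Σ-Fin : ∀ {A} (fa : Finite A) (c : A → ℕ) {K} → (∀ a → c a ≤ K) → size (finite-Σ-Fin fa c) ≤ size fa * K
size-Σ-Fin fa c bound = ∑-≤ (size fa) _ (bound ∘ Finite.element fa)

Σ-Fin-≡ : ∀ {A : Set} {c : A → ℕ} {a a′ : A} {i : Fin (c a)} {j : Fin (c a′)} →
          a ≡ a′ → toℕ i ≡ toℕ j → _≡_ {A = Σ A (Fin ∘ c)} (a , i) (a′ , j)
Σ-Fin-≡ refl i≡j = cong (_ ,_) (Finₚ.toℕ-injective i≡j)

module Transposition {X : Set} (_≟_ : DecidableEquality X) (a b : X) where

  swap : X → X
  swap z with z ≟ a | z ≟ b
  ... | yes _ | _     = b
  ... | no _  | yes _ = a
  ... | no _  | no _  = z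

  data Swapped (z : X) : X → Set where
    from-a : z ≡ a → Swapped z b
    from-b : z ≡ b → Swapped z a
    fixed  : z ≢ a → z ≢ b → Swapped z z

  swapped : ∀ z → Swapped z (swap z)
  swapped z with z ≟ a | z ≟ b
  ... | yes z≡a | _       = from-a z≡a
  ... | no _    | yes z≡b = from-b z≡b
  ... | no z≢a  | no z≢b  = fixed z≢a z≢b

  swap-a : swap a ≡ b
  swap-a with swap a | swapped a
  ... | _ | from-a _   = refl
  ... | _ | from-b a≡b = a≡b
  ... | _ | fixed a≢a _ = ⊥-elim (a≢a refl)

  swap-b : swap b ≡ a
  swap-b with swap b | swapped b
  ... | _ | from-a b≡a = b≡a
  ... | _ | from-b _   = refl
  ... | _ | fixed _ b≢b = ⊥-elim (b≢b refl)

  swap-fixes : ∀ {z} → z ≢ a → z ≢ b → swap z ≡ z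
  swap-fixes {z} z≢a z≢b with swap z | swapped z
  ... | _ | from-a z≡a = ⊥-elim (z≢a z≡a)
  ... | _ | from-b z≡b = ⊥-elim (z≢b z≡b)
  ... | _ | fixed _ _  = refl

  swap-involutive : ∀ z → swap (swap z) ≡ z
  swap-involutive z with swap z | swapped z
  ... | _ | from-a z≡a      = trans swap-b (sym z≡a)
  ... | _ | from-b z≡b      = trans swap-a (sym z≡b)
  ... | _ | fixed z≢a z≢b   = swap-fixes z≢a z≢b

  swap-preserves : ∀ {Y : Set} (f : X → Y) → f a ≡ f b → ∀ z → f (swap z) ≡ f z
  swap-preserves f fa≡fb z with swap z | swapped z
  ... | _ | from-a z≡a = trans (sym fa≡fb) (cong f (sym z≡a))
  ... | _ | from-b z≡b = trans fa≡fb (cong f (sym z≡b))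
  ... | _ | fixed _ _  = refl

injection-avoids : ∀ {X : Set} → DecidableEquality X → ∀ {n c} (ρ : Fin n → X) (h : Fin c → X) →
                   Injective _≡_ _≡_ h → n < c → ∃ λ i → ∀ j → ρ j ≢ h i
injection-avoids _≟_ {n} {c} ρ h h-injective n<c
  with Finₚ.any? (λ i → Finₚ.all? (λ j → ¬? (ρ j ≟ h i)))
... | yes avoiding = avoiding
... | no none = ⊥-elim (collision (Finₚ.pigeonhole n<c (proj₁ ∘ hit)))
  where
    hit : ∀ i → ∃ λ j → ρ j ≡ h i
    hit i with Finₚ.any? (λ j → ρ j ≟ h i)
    ... | yes found = found
    ... | no missed = ⊥-elim (none (i , λ j ρj≡hi → missed (j , ρj≡hi)))
    collision : ¬ ∃ λ i → ∃ λ j → i Fin.< j × proj₁ (hit i) ≡ proj₁ (hit j)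
    collision (i , j , i<j , same) =
      Finₚ.<⇒≢ i<j (h-injective (trans (sym (proj₂ (hit i))) (trans (cong ρ same) (proj₂ (hit j)))))

module Selection {X Y : Set} (_≟_ : DecidableEquality X) (label : X → Y) (K : ℕ) where

  Complete : ∀ {c} → Y → (Fin c → X) → Set
  Complete y rep = ∀ x → label x ≡ y → ∃ λ j → rep j ≡ x

  -- Whether the class of y has more than m members is undecidable in general
  -- (e.g. for the positions of an infinite execution), so samples only exist under ¬¬.
  record Sample (m : ℕ) (y : Y) : Set where
    field
      count : ℕ
      count≤K : count ≤ K
      rep : Fin count → X
      rep-injective : Injective _≡_ _≡_ rep
      label-rep : ∀ j → label (rep j) ≡ y
      complete-or-large : Complete y rep ⊎ m ≤ count

  Representatives : Y → Set
  Representatives = Sample K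

  empty-sample : ∀ {y} → Sample 0 y
  empty-sample = record
    { count = 0 ; count≤K = z≤n ; rep = λ () ; rep-injective = λ { {()} }
    ; label-rep = λ () ; complete-or-large = inj₂ z≤n }

  reassess : ∀ {m m' y} (smp : Sample m y) →
             Complete y (Sample.rep smp) ⊎ m' ≤ Sample.count smp → Sample m' y
  reassess smp guarantee = record
    { count = count ; count≤K = count≤K ; rep = rep ; rep-injective = rep-injective
    ; label-rep = label-rep ; complete-or-large = guarantee }
    where open Sample smp

  grow-sample : ∀ {m y} → suc m ≤ K → Sample m y → ¬¬ Sample (suc m) y
  grow-sample {m} {y} m<K smp with Sample.complete-or-large smp
  ... | inj₁ complete = return (reassess smp (inj₁ complete))
  ... | inj₂ m≤count with ℕₚ.m≤n⇒m<n∨m≡n m≤count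
  ...   | inj₁ m<count = return (reassess smp (inj₂ m<count))
  ...   | inj₂ refl = do
            unsampled? ← ¬¬-excluded-middle
            return (grow unsampled?)
    where
      open Sample smp
      grow : Dec (∃ λ x → label x ≡ y × ∀ j → rep j ≢ x) → Sample (suc m) y
      grow (yes (x , label-x , fresh)) = record
        { count = suc m ; count≤K = m<K ; rep = x Vector.∷ rep
        ; rep-injective = λ { {zero} {zero} _ → refl
                            ; {zero} {suc j} x≡rep → ⊥-elim (fresh j (sym x≡rep))
                            ; {suc i} {zero} rep≡x → ⊥-elim (fresh i rep≡x)
                            ; {suc i} {suc j} rep≡rep → cong suc (rep-injective rep≡rep) }
        ; label-rep = λ { zero → label-x ; (suc j) → label-rep j }
        ; complete-or-large = inj₂ ℕₚ.≤-refl }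
      grow (no none-unsampled) = reassess smp (inj₁ complete)
        where
          complete : Complete y rep
          complete x label-x with Finₚ.any? (λ j → rep j ≟ x)
          ... | yes sampled = sampled
          ... | no unsampled = ⊥-elim (none-unsampled (x , label-x , λ j rep≡x → unsampled (j , rep≡x)))

  module _ (reps : ∀ y → Representatives y) where

    all-reps : Σ Y (Fin ∘ Sample.count ∘ reps) → X
    all-reps (y , j) = Sample.rep (reps y) j

    all-reps-injective : Injective _≡_ _≡_ all-reps
    all-reps-injective {y , i} {y′ , j} same
      with trans (sym (Sample.label-rep (reps y) i)) (trans (cong label same) (Sample.label-rep (reps y′) j))
    ... | refl = cong (y ,_) (Sample.rep-injective (reps y) same)

  sample : ∀ {y} m → m ≤ K → ¬¬ Sample m y
  sample zero _ = return empty-sample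
  sample (suc m) m<K = sample m (ℕₚ.<⇒≤ m<K) >>= grow-sample m<K

  representatives : Finite Y → ¬¬ (∀ y → Representatives y)
  representatives fy = do
    reps ← Finₚ.sequence rawApplicative (λ i → sample {Finite.element fy i} K ℕₚ.≤-refl)
    return (λ y → subst Representatives (Finite.element-index fy y) (reps (Finite.index fy y)))

_≟ᵀ_ : DecidableEquality PType
s ≟ᵀ s = yes refl
s ≟ᵀ e = no λ ()
s ≟ᵀ se = no λ ()
e ≟ᵀ s = no λ ()
e ≟ᵀ e = yes refl
e ≟ᵀ se = no λ ()
se ≟ᵀ s = no λ ()
se ≟ᵀ e = no λ ()
se ≟ᵀ se = yes refl

rank : ∀ {ns ne n} → Formula ns ne n → ℕ
rank (neg φ) = rank φ
rank (φ ∨' ψ) = rank φ ⊔ rank ψ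
rank (∃' φ) = suc (rank φ)
rank _ = 0

module Structures (ns ne : ℕ) where

  record Structure : Set₁ where
    field
      Process : Set
      Position : Set
      typeOf : Process → PType
      ownerOf : Position → Process
      actionOf : Position → Act ns ne

  open Structure public

  ∣_∣ : Structure → Set
  ∣ S ∣ = Process S ⊎ Position S

  owner : (S : Structure) → ∣ S ∣ → Process S
  owner S (inj₁ p) = p
  owner S (inj₂ x) = ownerOf S x

  HasType : (S : Structure) → ∣ S ∣ → PType → Set
  HasType S (inj₁ p) θ = typeOf S p ≡ θ
  HasType S (inj₂ _) θ = ⊥

  HasAction : (S : Structure) → ∣ S ∣ → Act ns ne → Set
  HasAction S (inj₁ _) a = ⊥
  HasAction S (inj₂ x) a = actionOf S x ≡ a

  _⊨_[_] : (S : Structure) {n : ℕ} → Formula ns ne n → (Fin n → ∣ S ∣) → Set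
  S ⊨ typ θ x [ ρ ] = HasType S (ρ x) θ
  S ⊨ act a x [ ρ ] = HasAction S (ρ x) a
  S ⊨ eq x y [ ρ ] = ρ x ≡ ρ y
  S ⊨ sim x y [ ρ ] = owner S (ρ x) ≡ owner S (ρ y)
  S ⊨ neg φ [ ρ ] = ¬ S ⊨ φ [ ρ ]
  S ⊨ φ ∨' ψ [ ρ ] = S ⊨ φ [ ρ ] ⊎ S ⊨ ψ [ ρ ]
  S ⊨ ∃' φ [ ρ ] = ∃ λ u → S ⊨ φ [ u Vector.∷ ρ ]

  _⊨_ : Structure → Sentence ns ne → Set
  S ⊨ φ = S ⊨ φ [ (λ ()) ]

  ⊨-cong : ∀ S {n} (φ : Formula ns ne n) {ρ ρ′} → (∀ i → ρ i ≡ ρ′ i) → S ⊨ φ [ ρ ] → S ⊨ φ [ ρ′ ]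
  ⊨-cong S (typ θ x) ρ≗ρ′ = subst (λ u → HasType S u θ) (ρ≗ρ′ x)
  ⊨-cong S (act a x) ρ≗ρ′ = subst (λ u → HasAction S u a) (ρ≗ρ′ x)
  ⊨-cong S (eq x y) ρ≗ρ′ = subst₂ _≡_ (ρ≗ρ′ x) (ρ≗ρ′ y)
  ⊨-cong S (sim x y) ρ≗ρ′ = subst₂ (λ u v → owner S u ≡ owner S v) (ρ≗ρ′ x) (ρ≗ρ′ y)
  ⊨-cong S (neg φ) ρ≗ρ′ ¬sat sat = ¬sat (⊨-cong S φ (sym ∘ ρ≗ρ′) sat)
  ⊨-cong S (φ ∨' ψ) ρ≗ρ′ = Sum.map (⊨-cong S φ ρ≗ρ′) (⊨-cong S ψ ρ≗ρ′)
  ⊨-cong S (∃' φ) ρ≗ρ′ (u , sat) = u , ⊨-cong S φ (λ { zero → refl ; (suc i) → ρ≗ρ′ i }) sat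

  ⊨-dec : ∀ S → Finite (Process S) → Finite (Position S) →
          ∀ {n} (φ : Formula ns ne n) ρ → Dec (S ⊨ φ [ ρ ])
  ⊨-dec S fp fx = go
    where
      open Finite (finite-⊎ fp fx) using (_≟_; any?)
      go : ∀ {n} (φ : Formula ns ne n) ρ → Dec (S ⊨ φ [ ρ ])
      go (typ θ x) ρ with ρ x
      ... | inj₁ p = typeOf S p ≟ᵀ θ
      ... | inj₂ _ = no λ ()
      go (act a x) ρ with ρ x
      ... | inj₁ _ = no λ ()
      ... | inj₂ y = ⊎ₚ.≡-dec Finₚ._≟_ Finₚ._≟_ (actionOf S y) a
      go (eq x y) ρ = ρ x ≟ ρ y
      go (sim x y) ρ = Finite._≟_ fp (owner S (ρ x)) (owner S (ρ y))
      go (neg φ) ρ = ¬? (go φ ρ)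
      go (φ ∨' ψ) ρ = go φ ρ ⊎-dec go ψ ρ
      go (∃' φ) ρ = any? (λ u → go φ (u Vector.∷ ρ))

  record Embedding (T S : Structure) : Set where
    field
      onProcess : Process T → Process S
      onPosition : Position T → Position S
      onProcess-injective : Injective _≡_ _≡_ onProcess
      onPosition-injective : Injective _≡_ _≡_ onPosition
      typeOf-onProcess : ∀ p → typeOf S (onProcess p) ≡ typeOf T p
      ownerOf-onPosition : ∀ x → ownerOf S (onPosition x) ≡ onProcess (ownerOf T x)
      actionOf-onPosition : ∀ x → actionOf S (onPosition x) ≡ actionOf T x

    lift : ∣ T ∣ → ∣ S ∣
    lift = Sum.map onProcess onPosition

    lift-injective : Injective _≡_ _≡_ lift
    lift-injective {inj₁ p} {inj₁ q} same = cong inj₁ (onProcess-injective (⊎ₚ.inj₁-injective same))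
    lift-injective {inj₂ x} {inj₂ y} same = cong inj₂ (onPosition-injective (⊎ₚ.inj₂-injective same))

    owner-lift : ∀ u → owner S (lift u) ≡ onProcess (owner T u)
    owner-lift (inj₁ p) = refl
    owner-lift (inj₂ x) = ownerOf-onPosition x

    HasType-lift : ∀ u θ → HasType T u θ ⇔ HasType S (lift u) θ
    HasType-lift (inj₁ p) θ = mk⇔ (trans (typeOf-onProcess p)) (trans (sym (typeOf-onProcess p)))
    HasType-lift (inj₂ x) θ = mk⇔ id id

    HasAction-lift : ∀ u a → HasAction T u a ⇔ HasAction S (lift u) a
    HasAction-lift (inj₁ p) a = mk⇔ id id
    HasAction-lift (inj₂ x) a = mk⇔ (trans (actionOf-onPosition x)) (trans (sym (actionOf-onPosition x)))

    same-owner-lift : ∀ u v → owner T u ≡ owner T v ⇔ owner S (lift u) ≡ owner S (lift v)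
    same-owner-lift u v = mk⇔
      (λ same → trans (owner-lift u) (trans (cong onProcess same) (sym (owner-lift v))))
      (λ same → onProcess-injective (trans (sym (owner-lift u)) (trans same (owner-lift v))))

  open Embedding public using (lift)

  -- The forth condition of the Ehrenfeucht–Fraïssé game of length K,
  -- with the Duplicator answering inside the image of m.
  Forth : {T S : Structure} → Embedding T S → ℕ → Set
  Forth {T} {S} m K = ∀ {n} → suc n ≤ K → (σ : Fin n → ∣ T ∣) (u : ∣ S ∣) (ψ : Formula ns ne (suc n)) →
    S ⊨ ψ [ u Vector.∷ lift m ∘ σ ] → ∃ λ v → S ⊨ ψ [ lift m v Vector.∷ lift m ∘ σ ]

  transfer : ∀ {T S} (m : Embedding T S) {K} → Forth m K →
             ∀ {n} (φ : Formula ns ne n) σ → n + rank φ ≤ K → T ⊨ φ [ σ ] ⇔ S ⊨ φ [ lift m ∘ σ ]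
  transfer m forth (typ θ x) σ _ = Embedding.HasType-lift m (σ x) θ
  transfer m forth (act a x) σ _ = Embedding.HasAction-lift m (σ x) a
  transfer m forth (eq x y) σ _ = mk⇔ (cong (lift m)) (Embedding.lift-injective m)
  transfer m forth (sim x y) σ _ = Embedding.same-owner-lift m (σ x) (σ y)
  transfer m forth (neg φ) σ bound =
    let ih = transfer m forth φ σ bound in
    mk⇔ (λ ¬satT satS → ¬satT (from ih satS)) (λ ¬satS satT → ¬satS (to ih satT))
  transfer m forth {n} (φ ∨' ψ) σ bound =
    let ihφ = transfer m forth φ σ (ℕₚ.≤-trans (ℕₚ.+-monoʳ-≤ n (ℕₚ.m≤m⊔n (rank φ) (rank ψ))) bound)
        ihψ = transfer m forth ψ σ (ℕₚ.≤-trans (ℕₚ.+-monoʳ-≤ n (ℕₚ.m≤n⊔m (rank φ) (rank ψ))) bound)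
    in mk⇔ (Sum.map (to ihφ) (to ihψ)) (Sum.map (from ihφ) (from ihψ))
  transfer {T} {S} m {K} forth {n} (∃' φ) σ bound = mk⇔
    (λ (v , satT) → lift m v , ⊨-cong S φ (lift-∷ v) (to (ih v) satT))
    (λ (u , satS) → let (v , satS′) = forth n<K σ u φ satS in
                    v , from (ih v) (⊨-cong S φ (sym ∘ lift-∷ v) satS′))
    where
      bound′ : suc n + rank φ ≤ K
      bound′ = subst (_≤ K) (ℕₚ.+-suc n (rank φ)) bound
      n<K : suc n ≤ K
      n<K = ℕₚ.≤-trans (ℕₚ.m≤m+n (suc n) (rank φ)) bound′
      ih : ∀ v → T ⊨ φ [ v Vector.∷ σ ] ⇔ S ⊨ φ [ lift m ∘ (v Vector.∷ σ) ]
      ih v = transfer m forth φ (v Vector.∷ σ) bound′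
      lift-∷ : ∀ v i → lift m ((v Vector.∷ σ) i) ≡ (lift m v Vector.∷ lift m ∘ σ) i
      lift-∷ v zero = refl
      lift-∷ v (suc i) = refl

  transfer-surjective : ∀ {T S} (m : Embedding T S) → (∀ u → ∃ λ v → lift m v ≡ u) →
                        ∀ {n} (φ : Formula ns ne n) σ → T ⊨ φ [ σ ] ⇔ S ⊨ φ [ lift m ∘ σ ]
  transfer-surjective {S = S} m surjective {n} φ σ = transfer m forth φ σ ℕₚ.≤-refl
    where
      forth : Forth m (n + rank φ)
      forth _ σ u ψ sat = let (v , v↦u) = surjective u in
        v , ⊨-cong S ψ (λ { zero → sym v↦u ; (suc i) → refl }) sat

  record Involution (S : Structure) : Set where
    field
      onProcess : Process S → Process S
      onPosition : Position S → Position S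
      onProcess-involutive : ∀ p → onProcess (onProcess p) ≡ p
      onPosition-involutive : ∀ x → onPosition (onPosition x) ≡ x
      typeOf-onProcess : ∀ p → typeOf S (onProcess p) ≡ typeOf S p
      ownerOf-onPosition : ∀ x → ownerOf S (onPosition x) ≡ onProcess (ownerOf S x)
      actionOf-onPosition : ∀ x → actionOf S (onPosition x) ≡ actionOf S x

    embedding : Embedding S S
    embedding = record
      { onProcess = onProcess ; onPosition = onPosition
      ; onProcess-injective = λ {p} {q} same →
          trans (sym (onProcess-involutive p)) (trans (cong onProcess same) (onProcess-involutive q))
      ; onPosition-injective = λ {x} {y} same →
          trans (sym (onPosition-involutive x)) (trans (cong onPosition same) (onPosition-involutive y))
      ; typeOf-onProcess = typeOf-onProcess ; ownerOf-onPosition = ownerOf-onPosition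
      ; actionOf-onPosition = actionOf-onPosition }

    apply : ∣ S ∣ → ∣ S ∣
    apply = lift embedding

    apply-involutive : ∀ u → apply (apply u) ≡ u
    apply-involutive (inj₁ p) = cong inj₁ (onProcess-involutive p)
    apply-involutive (inj₂ x) = cong inj₂ (onPosition-involutive x)

  id-involution : ∀ S → Involution S
  id-involution S = record
    { onProcess = id ; onPosition = id
    ; onProcess-involutive = λ _ → refl ; onPosition-involutive = λ _ → refl
    ; typeOf-onProcess = λ _ → refl ; ownerOf-onPosition = λ _ → refl ; actionOf-onPosition = λ _ → refl }

  apply-id : ∀ {S} u → Involution.apply (id-involution S) u ≡ u
  apply-id (inj₁ p) = refl
  apply-id (inj₂ x) = refl

  MovableInto : ∀ {T S} → Embedding T S → ∀ {n} → (Fin n → ∣ T ∣) → ∣ S ∣ → Set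
  MovableInto {S = S} m σ u = Σ (Involution S) λ α → ∃ λ v →
    Involution.apply α (lift m v) ≡ u × ∀ i → Involution.apply α (lift m (σ i)) ≡ lift m (σ i)

  image-movable : ∀ {T S} (m : Embedding T S) {n} (σ : Fin n → ∣ T ∣) {u} →
                  (∃ λ v → lift m v ≡ u) → MovableInto m σ u
  image-movable {S = S} m σ (v , v↦u) =
    id-involution S , v , trans (apply-id {S} (lift m v)) v↦u , λ k → apply-id {S} (lift m (σ k))

  -- Rather than being answered directly, the Spoiler's move u is carried into the
  -- image of m by an automorphism that fixes the pebbled elements.
  forth-by-involutions : ∀ {T S} (m : Embedding T S) K →
    (∀ {n} → suc n ≤ K → (σ : Fin n → ∣ T ∣) (u : ∣ S ∣) → MovableInto m σ u) → Forth m K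
  forth-by-involutions {S = S} m K movable n<K σ u ψ sat with movable n<K σ u
  ... | α , v , v↦u , fixes =
    v , from (transfer-surjective α̂ surjective ψ (lift m v Vector.∷ lift m ∘ σ)) (⊨-cong S ψ moved sat)
    where
      α̂ : Embedding S S
      α̂ = Involution.embedding α
      surjective : ∀ u′ → ∃ λ v′ → lift α̂ v′ ≡ u′
      surjective u′ = lift α̂ u′ , Involution.apply-involutive α u′
      moved : ∀ i → (u Vector.∷ lift m ∘ σ) i ≡ lift α̂ ((lift m v Vector.∷ lift m ∘ σ) i)
      moved zero = sym v↦u
      moved (suc i) = sym (fixes i)

  reflect-sentence : ∀ {T S} (m : Embedding T S) {K} → Forth m K →
                     (φ : Sentence ns ne) → rank φ ≤ K → S ⊨ φ → T ⊨ φ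
  reflect-sentence {S = S} m forth φ rank≤K = from (transfer m forth φ _ rank≤K) ∘ ⊨-cong S φ (λ ())

  preserve-sentence : ∀ {T S} (m : Embedding T S) → (∀ u → ∃ λ v → lift m v ≡ u) →
                      (φ : Sentence ns ne) → T ⊨ φ → S ⊨ φ
  preserve-sentence {S = S} m surjective φ = ⊨-cong S φ (λ ()) ∘ to (transfer-surjective m surjective φ _)

module Executions (ns ne ks ke kse : ℕ) where
  open Exec ns ne ks ke kse hiding (HasType)
  open Structures ns ne

  record EventFamily : Set₁ where
    field
      Point : Set
      _≟_ : DecidableEquality Point
      event : Point → Event

  structure : EventFamily → Structure
  structure L = record
    { Process = Proc ; Position = Point ; typeOf = procType
    ; ownerOf = proc ∘ event ; actionOf = action ∘ event }
    where open EventFamily L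

  _≟ᴾ_ : ∀ {w} → DecidableEquality (Pos w)
  _≟ᴾ_ {fin l} = Finₚ._≟_
  _≟ᴾ_ {inf g} = ℕₚ._≟_

  positions : Execution → EventFamily
  positions w = record { Point = Pos w ; _≟_ = _≟ᴾ_ ; event = evAt w }

  ∼⇔same-owner : ∀ w (u v : Univ w) →
                 EqClosure (Gen w) u v ⇔ owner (structure (positions w)) u ≡ owner (structure (positions w)) v
  ∼⇔same-owner w u v = mk⇔ (Closure.gfold isEquivalence (owner S) generator-same-owner) same-owner-∼
    where
      S : Structure
      S = structure (positions w)
      generator-same-owner : ∀ {u v} → Gen w u v → owner S u ≡ owner S v
      generator-same-owner (pe i) = refl
      generator-same-owner (ee i j same) = same
      owner-∼ : ∀ u → EqClosure (Gen w) (inj₁ (owner S u)) u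
      owner-∼ (inj₁ p) = Closure.reflexive (Gen w)
      owner-∼ (inj₂ i) = Closure.return (pe i)
      same-owner-∼ : owner S u ≡ owner S v → EqClosure (Gen w) u v
      same-owner-∼ same = Closure.transitive (Gen w) (Closure.symmetric (Gen w) (owner-∼ u))
                            (subst (λ p → EqClosure (Gen w) (inj₁ p) v) (sym same) (owner-∼ v))

  Sat⇔⊨ : ∀ w {n} (φ : Formula ns ne n) ρ → Sat w φ ρ ⇔ structure (positions w) ⊨ φ [ ρ ]
  Sat⇔⊨ w (typ θ x) ρ with ρ x
  ... | inj₁ _ = mk⇔ id id
  ... | inj₂ _ = mk⇔ id id
  Sat⇔⊨ w (act a x) ρ with ρ x
  ... | inj₁ _ = mk⇔ id id
  ... | inj₂ _ = mk⇔ id id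
  Sat⇔⊨ w (eq x y) ρ = mk⇔ id id
  Sat⇔⊨ w (sim x y) ρ = ∼⇔same-owner w (ρ x) (ρ y)
  Sat⇔⊨ w (neg φ) ρ = let ih = Sat⇔⊨ w φ ρ in mk⇔ (λ ¬sat → ¬sat ∘ from ih) (λ ¬sat → ¬sat ∘ to ih)
  Sat⇔⊨ w (φ ∨' ψ) ρ = let ihφ = Sat⇔⊨ w φ ρ ; ihψ = Sat⇔⊨ w ψ ρ in
    mk⇔ (Sum.map (to ihφ) (to ihψ)) (Sum.map (from ihφ) (from ihψ))
  Sat⇔⊨ w (∃' φ) ρ = mk⇔
    (λ (u , sat) → u , ⊨-cong S φ extend≗∷ (to (Sat⇔⊨ w φ (extend u ρ)) sat))
    (λ (u , sat) → u , from (Sat⇔⊨ w φ (extend u ρ)) (⊨-cong S φ (sym ∘ extend≗∷) sat))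
    where
      S : Structure
      S = structure (positions w)
      extend≗∷ : ∀ {u} i → extend u ρ i ≡ (u Vector.∷ ρ) i
      extend≗∷ zero = refl
      extend≗∷ (suc i) = refl

  Models⇔⊨ : ∀ w (φ : Sentence ns ne) → Models w φ ⇔ structure (positions w) ⊨ φ
  Models⇔⊨ w φ = mk⇔ (⊨-cong S φ (λ ()) ∘ to (Sat⇔⊨ w φ _)) (from (Sat⇔⊨ w φ _) ∘ ⊨-cong S φ (λ ()))
    where S = structure (positions w)

  finite-Proc : Finite Proc
  finite-Proc = finite-⊎ finite-Fin (finite-⊎ finite-Fin finite-Fin)

  Event↔ : Event ↔ ((Fin ns × (Fin ks ⊎ Fin kse)) ⊎ (Fin ne × (Fin ke ⊎ Fin kse)))
  Event↔ = mk↔ₛ′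
    (λ { (sev a p) → inj₁ (a , p) ; (eev a p) → inj₂ (a , p) })
    (λ { (inj₁ (a , p)) → sev a p ; (inj₂ (a , p)) → eev a p })
    (λ { (inj₁ _) → refl ; (inj₂ _) → refl })
    (λ { (sev _ _) → refl ; (eev _ _) → refl })

  finite-Event : Finite Event
  finite-Event = finite-↔ Event↔ (finite-⊎ (finite-× finite-Fin (finite-⊎ finite-Fin finite-Fin))
                                            (finite-× finite-Fin (finite-⊎ finite-Fin finite-Fin)))

  Models-dec : ∀ l (φ : Sentence ns ne) → Dec (Models (fin l) φ)
  Models-dec l φ = map′ (from (Models⇔⊨ (fin l) φ)) (to (Models⇔⊨ (fin l) φ))
                        (⊨-dec (structure (positions (fin l))) finite-Proc finite-Fin φ _)

  SmallModel : ℕ → Sentence ns ne → Set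
  SmallModel B φ = ∃ λ l → length l ≤ B × Models (fin l) φ

  small-model? : ∀ B φ → Dec (SmallModel B φ)
  small-model? B φ = map′ as-list as-vector
    (ℕₚ.anyUpTo? (λ m → Finite.any? (finite-Vec m finite-Event) (λ v → Models-dec (Vec.toList v) φ)) (suc B))
    where
      as-list : (∃ λ m → m < suc B × ∃ λ (v : Vec Event m) → Models (fin (Vec.toList v)) φ) → SmallModel B φ
      as-list (m , m<1+B , v , model) =
        Vec.toList v , subst (_≤ B) (sym (Vecₚ.length-toList v)) (ℕₚ.≤-pred m<1+B) , model
      as-vector : SmallModel B φ → ∃ λ m → m < suc B × ∃ λ (v : Vec Event m) → Models (fin (Vec.toList v)) φ
      as-vector (l , length≤B , model) =
        length l , s≤s length≤B , Vec.fromList l ,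
        subst (λ l′ → Models (fin l′) φ) (sym (Vecₚ.toList∘fromList l)) model

  counts : (Event → ℕ) → EventFamily
  counts c = record { Point = Σ Event (Fin ∘ c) ; _≟_ = Finite._≟_ (finite-Σ-Fin finite-Event c) ; event = proj₁ }

  swap-points : ∀ L (x y : EventFamily.Point L) → EventFamily.event L x ≡ EventFamily.event L y →
                Involution (structure L)
  swap-points L x y same-event = record
    { onProcess = id ; onPosition = swap
    ; onProcess-involutive = λ _ → refl ; onPosition-involutive = swap-involutive
    ; typeOf-onProcess = λ _ → refl
    ; ownerOf-onPosition = swap-preserves (proc ∘ event) (cong proc same-event)
    ; actionOf-onPosition = swap-preserves (action ∘ event) (cong action same-event) }
    where
      open EventFamily L
      open Transposition _≟_ x y

  module PositionReduction (L : EventFamily) (K : ℕ) where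
    open EventFamily L
    open Selection _≟_ event K

    module _ (reps : ∀ E → Representatives E) where
      open module Reps E = Sample (reps E) using (count; rep; rep-injective; label-rep)

      embedding : Embedding (structure (counts count)) (structure L)
      embedding = record
        { onProcess = id ; onPosition = all-reps reps
        ; onProcess-injective = id ; onPosition-injective = all-reps-injective reps
        ; typeOf-onProcess = λ _ → refl
        ; ownerOf-onPosition = λ (E , j) → cong proc (label-rep E j)
        ; actionOf-onPosition = λ (E , j) → cong action (label-rep E j) }

      forth : Forth embedding K
      forth = forth-by-involutions embedding K movable
        where
          S : Structure
          S = structure L
          ≟-∣S∣ : DecidableEquality ∣ S ∣
          ≟-∣S∣ = ⊎ₚ.≡-dec (Finite._≟_ finite-Proc) _≟_
          movable : ∀ {n} → suc n ≤ K → (σ : Fin n → ∣ structure (counts count) ∣) (u : ∣ S ∣) →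
                    MovableInto embedding σ u
          movable n<K σ (inj₁ p) = image-movable embedding σ (inj₁ p , refl)
          movable n<K σ (inj₂ x) with Finₚ.any? (λ j → rep (event x) j ≟ x)
          ... | yes (j , rep≡x) = image-movable embedding σ (inj₂ (event x , j) , cong inj₂ rep≡x)
          ... | no unsampled with Reps.complete-or-large (event x)
          ...   | inj₁ complete = ⊥-elim (unsampled (complete x refl))
          ...   | inj₂ K≤count = α , inj₂ (E , i) , cong inj₂ swap-b , fixes
            where
              E : Event
              E = event x
              avoiding : ∃ λ i → ∀ k → lift embedding (σ k) ≢ inj₂ (rep E i)
              avoiding = injection-avoids ≟-∣S∣ (lift embedding ∘ σ) (inj₂ ∘ rep E)
                           (rep-injective E ∘ ⊎ₚ.inj₂-injective) (ℕₚ.≤-trans n<K K≤count)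
              i : Fin (count E)
              i = proj₁ avoiding
              open Transposition _≟_ x (rep E i)
              α : Involution S
              α = swap-points L x (rep E i) (sym (label-rep E i))
              fixes : ∀ k → Involution.apply α (lift embedding (σ k)) ≡ lift embedding (σ k)
              fixes k with σ k | proj₂ avoiding k
              ... | inj₁ p | _ = refl
              ... | inj₂ (E′ , j) | avoids =
                cong inj₂ (swap-fixes (λ rep≡x → unsampled (sampled rep≡x)) (avoids ∘ cong inj₂))
                where
                  sampled : rep E′ j ≡ x → ∃ λ j′ → rep E j′ ≡ x
                  sampled rep≡x with trans (sym (label-rep E′ j)) (cong event rep≡x)
                  ... | refl = j , rep≡x

    reduce-positions : (φ : Sentence ns ne) → rank φ ≤ K → structure L ⊨ φ →
                       ¬¬ ∃ λ c → (∀ E → c E ≤ K) × structure (counts c) ⊨ φ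
    reduce-positions φ rank≤K sat = do
      reps ← representatives finite-Event
      return (Sample.count ∘ reps , Sample.count≤K ∘ reps ,
              reflect-sentence (embedding reps) (forth reps) φ rank≤K sat)

  realize : ∀ c (φ : Sentence ns ne) → structure (counts c) ⊨ φ →
            ∃ λ l → length l ≡ size (finite-Σ-Fin finite-Event c) × Models (fin l) φ
  realize c φ sat = l , Listₚ.length-tabulate _ ,
                    from (Models⇔⊨ (fin l) φ) (preserve-sentence embedding surjective φ sat)
    where
      open Finite (finite-Σ-Fin finite-Event c) using (index; element; element-index; index-element; index-injective)
      l : List Event
      l = List.tabulate (proj₁ ∘ element)
      position : Σ Event (Fin ∘ c) → Fin (length l)
      position = cast (sym (Listₚ.length-tabulate _)) ∘ index
      position-injective : Injective _≡_ _≡_ position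
      position-injective {x} {y} same = index-injective (Finₚ.toℕ-injective
        (trans (sym (Finₚ.toℕ-cast _ (index x))) (trans (cong toℕ same) (Finₚ.toℕ-cast _ (index y)))))
      event-position : ∀ x → lookup l (position x) ≡ proj₁ x
      event-position x = trans (Listₚ.lookup-tabulate _ (index x)) (cong proj₁ (element-index x))
      embedding : Embedding (structure (counts c)) (structure (positions (fin l)))
      embedding = record
        { onProcess = id ; onPosition = position
        ; onProcess-injective = id ; onPosition-injective = position-injective
        ; typeOf-onProcess = λ _ → refl
        ; ownerOf-onPosition = cong proc ∘ event-position
        ; actionOf-onPosition = cong action ∘ event-position }
      surjective : ∀ u → ∃ λ v → lift embedding v ≡ u
      surjective (inj₁ p) = inj₁ p , refl
      surjective (inj₂ i) = inj₂ (element (cast (Listₚ.length-tabulate _) i)) , cong inj₂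
        (trans (cong (cast (sym length≡)) (index-element _)) (Finₚ.cast-involutive (sym length≡) length≡ i))
        where
          length≡ : length l ≡ size (finite-Σ-Fin finite-Event c)
          length≡ = Listₚ.length-tabulate (proj₁ ∘ element)

  small-model : ∀ {K} c (φ : Sentence ns ne) → (∀ E → c E ≤ K) → structure (counts c) ⊨ φ →
                SmallModel (size finite-Event * K) φ
  small-model c φ c≤K sat with realize c φ sat
  ... | l , length≡ , model = l , subst (_≤ _) (sym length≡) (size-Σ-Fin finite-Event c c≤K) , model

  finite-model : ∀ g (φ : Sentence ns ne) → Models (inf g) φ → ∃ λ l → Models (fin l) φ
  finite-model g φ model with decidable-stable (small-model? (size finite-Event * rank φ) φ) small-model-exists
    where
      open PositionReduction (positions (inf g)) (rank φ)
      small-model-exists : ¬¬ SmallModel (size finite-Event * rank φ) φ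
      small-model-exists = do
        c , c≤K , sat ← reduce-positions φ ℕₚ.≤-refl (to (Models⇔⊨ (inf g) φ) model)
        return (small-model c φ c≤K sat)
  ... | l , _ , model′ = l , model′

module ProcessReduction (ns ne ke kse : ℕ) where
  open Structures ns ne
  module Ex (ks : ℕ) = Executions ns ne ks ke kse
  open Ex using (structure; counts)

  Event : ℕ → Set
  Event ks = Exec.Event ns ne ks ke kse

  Proc : ℕ → Set
  Proc ks = Exec.Proc ns ne ks ke kse

  proc : ∀ {ks} → Event ks → Proc ks
  proc {ks} = Exec.proc ns ne ks ke kse

  action : ∀ {ks} → Event ks → Act ns ne
  action {ks} = Exec.action ns ne ks ke kse

  procType : ∀ {ks} → Proc ks → PType
  procType {ks} = Exec.procType ns ne ks ke kse

  relabelProc : ∀ {ks′ ks} → (Fin ks′ → Fin ks) → Proc ks′ → Proc ks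
  relabelProc π = Sum.map π id

  relabel : ∀ {ks′ ks} → (Fin ks′ → Fin ks) → Event ks′ → Event ks
  relabel π (Exec.sev a (inj₁ p)) = Exec.sev a (inj₁ (π p))
  relabel π (Exec.sev a (inj₂ p)) = Exec.sev a (inj₂ p)
  relabel π (Exec.eev a p) = Exec.eev a p

  module _ {ks′ ks} (π : Fin ks′ → Fin ks) where

    proc-relabel : ∀ E → proc (relabel π E) ≡ relabelProc π (proc E)
    proc-relabel (Exec.sev a (inj₁ p)) = refl
    proc-relabel (Exec.sev a (inj₂ p)) = refl
    proc-relabel (Exec.eev a (inj₁ p)) = refl
    proc-relabel (Exec.eev a (inj₂ p)) = refl

    action-relabel : ∀ E → action (relabel π E) ≡ action E
    action-relabel (Exec.sev a (inj₁ p)) = refl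
    action-relabel (Exec.sev a (inj₂ p)) = refl
    action-relabel (Exec.eev a p) = refl

    procType-relabelProc : ∀ p → procType (relabelProc π p) ≡ procType p
    procType-relabelProc (inj₁ p) = refl
    procType-relabelProc (inj₂ (inj₁ p)) = refl
    procType-relabelProc (inj₂ (inj₂ p)) = refl

    relabelProc-injective : Injective _≡_ _≡_ π → Injective _≡_ _≡_ (relabelProc π)
    relabelProc-injective π-injective {inj₁ p} {inj₁ q} same = cong inj₁ (π-injective (⊎ₚ.inj₁-injective same))
    relabelProc-injective π-injective {inj₂ p} {inj₂ q} refl = refl

    relabel-injective : Injective _≡_ _≡_ π → Injective _≡_ _≡_ (relabel π)
    relabel-injective π-injective {Exec.sev a (inj₁ p)} {Exec.sev a′ (inj₁ q)} same with sev-injective same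
      where
        sev-injective : ∀ {x y} → _≡_ {A = Event ks} (Exec.sev a (inj₁ x)) (Exec.sev a′ (inj₁ y)) → a ≡ a′ × x ≡ y
        sev-injective refl = refl , refl
    ... | refl , πp≡πq = cong (λ r → Exec.sev a (inj₁ r)) (π-injective πp≡πq)
    relabel-injective π-injective {Exec.sev a (inj₂ p)} {Exec.sev a′ (inj₂ q)} refl = refl
    relabel-injective π-injective {Exec.eev a p} {Exec.eev a′ q} refl = refl
    relabel-injective π-injective {Exec.sev a (inj₁ p)} {Exec.sev a′ (inj₂ q)} ()
    relabel-injective π-injective {Exec.sev a (inj₁ p)} {Exec.eev a′ q} ()
    relabel-injective π-injective {Exec.sev a (inj₂ p)} {Exec.sev a′ (inj₁ q)} ()
    relabel-injective π-injective {Exec.sev a (inj₂ p)} {Exec.eev a′ q} ()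
    relabel-injective π-injective {Exec.eev a p} {Exec.sev a′ (inj₁ q)} ()
    relabel-injective π-injective {Exec.eev a p} {Exec.sev a′ (inj₂ q)} ()

    relabel-preimage : ∀ E → (∀ p → proc E ≡ inj₁ p → ∃ λ q → π q ≡ p) → ∃ λ E′ → relabel π E′ ≡ E
    relabel-preimage (Exec.sev a (inj₁ p)) in-image with in-image p refl
    ... | q , πq≡p = Exec.sev a (inj₁ q) , cong (λ r → Exec.sev a (inj₁ r)) πq≡p
    relabel-preimage (Exec.sev a (inj₂ p)) _ = Exec.sev a (inj₂ p) , refl
    relabel-preimage (Exec.eev a p) _ = Exec.eev a p , refl

  module _ {ks} (π : Fin ks → Fin ks) where

    relabel-involutive : (∀ p → π (π p) ≡ p) → ∀ E → relabel π (relabel π E) ≡ E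
    relabel-involutive π-involutive (Exec.sev a (inj₁ p)) = cong (λ r → Exec.sev a (inj₁ r)) (π-involutive p)
    relabel-involutive π-involutive (Exec.sev a (inj₂ p)) = refl
    relabel-involutive π-involutive (Exec.eev a p) = refl

    relabel-fixes : ∀ E → (∀ p → proc E ≡ inj₁ p → π p ≡ p) → relabel π E ≡ E
    relabel-fixes (Exec.sev a (inj₁ p)) fixed = cong (λ r → Exec.sev a (inj₁ r)) (fixed p refl)
    relabel-fixes (Exec.sev a (inj₂ p)) _ = refl
    relabel-fixes (Exec.eev a p) _ = refl

  relabel-embedding : ∀ {ks′ ks} (c : Event ks → ℕ) (π : Fin ks′ → Fin ks) → Injective _≡_ _≡_ π →
                      Embedding (structure ks′ (counts ks′ (c ∘ relabel π))) (structure ks (counts ks c))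
  relabel-embedding c π π-injective = record
    { onProcess = relabelProc π ; onPosition = λ (E , j) → relabel π E , j
    ; onProcess-injective = relabelProc-injective π π-injective
    ; onPosition-injective = λ same →
        Σ-Fin-≡ (relabel-injective π π-injective (cong proj₁ same)) (cong (toℕ ∘ proj₂) same)
    ; typeOf-onProcess = procType-relabelProc π
    ; ownerOf-onPosition = proc-relabel π ∘ proj₁
    ; actionOf-onPosition = action-relabel π ∘ proj₁ }

  relabel-image : ∀ {ks′ ks} (c : Event ks → ℕ) (π : Fin ks′ → Fin ks) (π-injective : Injective _≡_ _≡_ π) →
                  ∀ u → (∀ p → owner (structure ks (counts ks c)) u ≡ inj₁ p → ∃ λ q → π q ≡ p) →
                  ∃ λ v → lift (relabel-embedding c π π-injective) v ≡ u
  relabel-image c π π-injective (inj₁ (inj₁ p)) in-image with in-image p refl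
  ... | q , πq≡p = inj₁ (inj₁ q) , cong (inj₁ ∘ inj₁) πq≡p
  relabel-image c π π-injective (inj₁ (inj₂ r)) _ = inj₁ (inj₂ r) , refl
  relabel-image c π π-injective (inj₂ (E , j)) in-image with relabel-preimage π E in-image
  ... | E′ , refl = inj₂ (E′ , j) , refl

  relabel-involution : ∀ {ks} (c : Event ks → ℕ) (π : Fin ks → Fin ks) → (∀ p → π (π p) ≡ p) →
                       (∀ E → c (relabel π E) ≡ c E) → Involution (structure ks (counts ks c))
  relabel-involution c π π-involutive c-relabel = record
    { onProcess = relabelProc π
    ; onPosition = λ (E , j) → relabel π E , cast (sym (c-relabel E)) j
    ; onProcess-involutive = λ { (inj₁ p) → cong inj₁ (π-involutive p) ; (inj₂ r) → refl }
    ; onPosition-involutive = λ (E , j) → Σ-Fin-≡ (relabel-involutive π π-involutive E)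
        (trans (Finₚ.toℕ-cast (sym (c-relabel (relabel π E))) _) (Finₚ.toℕ-cast (sym (c-relabel E)) j))
    ; typeOf-onProcess = procType-relabelProc π
    ; ownerOf-onPosition = proc-relabel π ∘ proj₁
    ; actionOf-onPosition = action-relabel π ∘ proj₁ }

  relabel-involution-fixes : ∀ {ks} (c : Event ks → ℕ) π π-involutive c-relabel u →
    (∀ p → owner (structure ks (counts ks c)) u ≡ inj₁ p → π p ≡ p) →
    Involution.apply (relabel-involution c π π-involutive c-relabel) u ≡ u
  relabel-involution-fixes c π _ c-relabel (inj₁ (inj₁ p)) fixed = cong (inj₁ ∘ inj₁) (fixed p refl)
  relabel-involution-fixes c π _ c-relabel (inj₁ (inj₂ r)) _ = refl
  relabel-involution-fixes c π _ c-relabel (inj₂ (E , j)) fixed =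
    cong inj₂ (Σ-Fin-≡ (relabel-fixes π E fixed) (Finₚ.toℕ-cast (sym (c-relabel E)) j))

  module _ {ks K : ℕ} (c : Event ks → ℕ) (c≤K : ∀ E → c E ≤ K) where

    -- A vector rather than a function, so that profiles form a finite type.
    profile : Fin ks → Vec (Fin (suc K)) ns
    profile p = Vec.tabulate λ a → Fin.fromℕ< (s≤s (c≤K (Exec.sev a (inj₁ p))))

    profile-count : ∀ p a → toℕ (Vec.lookup (profile p) a) ≡ c (Exec.sev a (inj₁ p))
    profile-count p a = trans (cong toℕ (Vecₚ.lookup∘tabulate _ a)) (Finₚ.toℕ-fromℕ< _)

    same-profile-count : ∀ {p q} → profile p ≡ profile q → ∀ a → c (Exec.sev a (inj₁ p)) ≡ c (Exec.sev a (inj₁ q))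
    same-profile-count {p} {q} same a =
      trans (sym (profile-count p a)) (trans (cong (λ τ → toℕ (Vec.lookup τ a)) same) (profile-count q a))

    finite-Profile : Finite (Vec (Fin (suc K)) ns)
    finite-Profile = finite-Vec ns finite-Fin

    open Selection Finₚ._≟_ profile K

    module _ (reps : ∀ τ → Representatives τ) where
      open module Reps τ = Sample (reps τ) using (count; rep; rep-injective; label-rep)

      finite-Selected : Finite (Σ (Vec (Fin (suc K)) ns) (Fin ∘ count))
      finite-Selected = finite-Σ-Fin finite-Profile count

      open Finite finite-Selected using (index; element; element-index; index-element)

      selected : Fin (size finite-Selected) → Fin ks
      selected = all-reps reps ∘ element

      selected-injective : Injective _≡_ _≡_ selected
      selected-injective {i} {j} same =
        trans (sym (index-element i)) (trans (cong index (all-reps-injective reps same)) (index-element j))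

      selected-index : ∀ τ j → selected (index (τ , j)) ≡ rep τ j
      selected-index τ j = cong (all-reps reps) (element-index (τ , j))

      embedding : Embedding (structure _ (counts _ (c ∘ relabel selected))) (structure ks (counts ks c))
      embedding = relabel-embedding c selected selected-injective

      S T : Structure
      S = structure ks (counts ks c)
      T = structure _ (counts _ (c ∘ relabel selected))

      owner-lift-selected : ∀ v p → owner S (lift embedding v) ≡ inj₁ p → ∃ λ q → selected q ≡ p
      owner-lift-selected v p owner≡ with owner T v | Embedding.owner-lift embedding v
      ... | inj₁ q | owner-lift = q , ⊎ₚ.inj₁-injective (trans (sym owner-lift) owner≡)
      ... | inj₂ r | owner-lift with () ← trans (sym owner-lift) owner≡

      swap-unselected : ∀ {n} → suc n ≤ K → (σ : Fin n → ∣ T ∣) (u : ∣ S ∣) → ∀ {p} → owner S u ≡ inj₁ p →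
                        ¬ (∃ λ q → selected q ≡ p) → K ≤ count (profile p) → MovableInto embedding σ u
      swap-unselected n<K σ u {p} owner≡ unselected K≤count =
        α , v , trans (cong (Involution.apply α) v↦αu) (Involution.apply-involutive α u) , fixes
        where
          τ : Vec (Fin (suc K)) ns
          τ = profile p
          avoiding : ∃ λ i → ∀ k → owner S (lift embedding (σ k)) ≢ inj₁ (rep τ i)
          avoiding = injection-avoids (Finite._≟_ (Ex.finite-Proc ks)) (owner S ∘ lift embedding ∘ σ)
                       (inj₁ ∘ rep τ) (rep-injective τ ∘ ⊎ₚ.inj₁-injective) (ℕₚ.≤-trans n<K K≤count)
          i : Fin (count τ)
          i = proj₁ avoiding
          open Transposition Finₚ._≟_ p (rep τ i)
          c-swap : ∀ E → c (relabel swap E) ≡ c E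
          c-swap (Exec.sev a (inj₁ z)) =
            swap-preserves (λ z → c (Exec.sev a (inj₁ z))) (same-profile-count (sym (label-rep τ i)) a) z
          c-swap (Exec.sev a (inj₂ _)) = refl
          c-swap (Exec.eev a _) = refl
          α : Involution S
          α = relabel-involution c swap swap-involutive c-swap
          owner-αu : owner S (Involution.apply α u) ≡ inj₁ (selected (index (τ , i)))
          owner-αu = trans (Embedding.owner-lift (Involution.embedding α) u)
                       (trans (cong (relabelProc swap) owner≡) (cong inj₁ (trans swap-a (sym (selected-index τ i)))))
          moved : ∃ λ v → lift embedding v ≡ Involution.apply α u
          moved = relabel-image c selected selected-injective (Involution.apply α u)
                    (λ p′ owner≡p′ → index (τ , i) , ⊎ₚ.inj₁-injective (trans (sym owner-αu) owner≡p′))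
          v : ∣ T ∣
          v = proj₁ moved
          v↦αu : lift embedding v ≡ Involution.apply α u
          v↦αu = proj₂ moved
          fixes : ∀ k → Involution.apply α (lift embedding (σ k)) ≡ lift embedding (σ k)
          fixes k = relabel-involution-fixes c swap swap-involutive c-swap (lift embedding (σ k)) λ p′ owner≡p′ →
            swap-fixes (λ { refl → unselected (owner-lift-selected (σ k) p′ owner≡p′) })
                       (λ { refl → proj₂ avoiding k owner≡p′ })

      movable : ∀ {n} → suc n ≤ K → (σ : Fin n → ∣ T ∣) (u : ∣ S ∣) → MovableInto embedding σ u
      movable n<K σ u with owner S u in owner≡
      ... | inj₂ r = image-movable embedding σ (relabel-image c selected selected-injective u
                       (λ p owner≡p → case trans (sym owner≡) owner≡p of λ ()))
      ... | inj₁ p with Finₚ.any? (λ q → selected q Finₚ.≟ p)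
      ...   | yes (q , selected≡p) = image-movable embedding σ (relabel-image c selected selected-injective u
                       (λ p′ owner≡p′ → q , trans selected≡p (⊎ₚ.inj₁-injective (trans (sym owner≡) owner≡p′))))
      ...   | no unselected with Reps.complete-or-large (profile p)
      ...     | inj₁ complete = let (j , rep≡p) = complete p refl in
                                ⊥-elim (unselected (index (profile p , j) , trans (selected-index _ j) rep≡p))
      ...     | inj₂ K≤count = swap-unselected n<K σ u owner≡ unselected K≤count

    reduce-processes : (φ : Sentence ns ne) → rank φ ≤ K → structure ks (counts ks c) ⊨ φ →
      ¬¬ ∃ λ ks′ → ks′ ≤ size finite-Profile * K × ∃ λ (c′ : Event ks′ → ℕ) → (∀ E → c′ E ≤ K) ×
         structure ks′ (counts ks′ c′) ⊨ φ
    reduce-processes φ rank≤K sat = do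
      reps ← representatives finite-Profile
      return (_ , size-Σ-Fin finite-Profile (Sample.count ∘ reps) (Sample.count≤K ∘ reps) ,
              c ∘ relabel (selected reps) , c≤K ∘ relabel (selected reps) ,
              reflect-sentence (embedding reps) (forth-by-involutions (embedding reps) K (movable reps)) φ rank≤K sat)

module Runs (ns ne ks ke kse : ℕ) (f : Exec.Strategy ns ne ks ke kse) where
  open Exec ns ne ks ke kse

  toEvent : SysEvent → Event
  toEvent (a , p) = sev a p

  step : List Event → Maybe SysEvent → List Event
  step u nothing = u
  step u (just σ) = u ∷ʳ toEvent σ

  play : ℕ → List Event
  play zero = []
  play (suc n) = step (play n) (f (play n))

  Follows : List Event → List Event → Set
  Follows u [] = ⊤
  Follows u (x ∷ xs) = f u ≡ toSys x × Follows (u ∷ʳ x) xs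

  follows-∷ʳ : ∀ u xs σ → Follows u xs → f (u ++ xs) ≡ just σ → Follows u (xs ∷ʳ toEvent σ)
  follows-∷ʳ u [] σ _ move = subst (λ h → f h ≡ just σ) (Listₚ.++-identityʳ u) move , tt
  follows-∷ʳ u (x ∷ xs) σ (fx , rest) move =
    fx , follows-∷ʳ (u ∷ʳ x) xs σ rest (subst (λ h → f h ≡ just σ) (sym (Listₚ.++-assoc u (x ∷ []) xs)) move)

  follows-play : ∀ n → Follows [] (play n)
  follows-play zero = tt
  follows-play (suc n) with f (play n) in move
  ... | nothing = follows-play n
  ... | just σ = follows-∷ʳ [] (play n) σ (follows-play n) move

  follows-lookup : ∀ u xs → Follows u xs → ∀ i → f (u ++ List.take (toℕ i) xs) ≡ toSys (lookup xs i)
  follows-lookup u (x ∷ xs) (fx , _) zero = subst (λ h → f h ≡ toSys x) (sym (Listₚ.++-identityʳ u)) fx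
  follows-lookup u (x ∷ xs) (_ , rest) (suc i) =
    subst (λ h → f h ≡ _) (Listₚ.++-assoc u (x ∷ []) (List.take (toℕ i) xs)) (follows-lookup (u ∷ʳ x) xs rest i)

  play-compatible : ∀ n → Compatible f (fin (play n))
  play-compatible n i σ sys = trans (follows-lookup [] (play n) (follows-play n) i) sys

  module Endless (move : ∀ n → ∃ λ σ → f (play n) ≡ just σ) where

    run : ℕ → Event
    run n = toEvent (proj₁ (move n))

    play-suc : ∀ n → play (suc n) ≡ play n ∷ʳ run n
    play-suc n = step-just (proj₂ (move n))
      where
        step-just : ∀ {u m σ} → m ≡ just σ → step u m ≡ u ∷ʳ toEvent σ
        step-just refl = refl

    play-prefix : ∀ n → play n ≡ infPrefix run n
    play-prefix n = trans (applied n) (sym (Listₚ.map-upTo run n))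
      where
        applied : ∀ n → play n ≡ List.applyUpTo run n
        applied zero = refl
        applied (suc n) = trans (play-suc n) (trans (cong (_∷ʳ run n) (applied n)) (Listₚ.applyUpTo-∷ʳ run n))

    run-compatible : Compatible f (inf run)
    run-compatible i σ sys with move i
    ... | σ′ , move-i with refl ← sys = subst (λ h → f h ≡ just σ′) (play-prefix i) move-i

    run-fair : Fair f (inf run)
    run-fair _ n = n , ℕₚ.≤-refl , Maybe.just tt

  strategy-model : (φ : Sentence ns ne) → Winning f φ → ¬¬ ∃ λ w → Models w φ
  strategy-model φ winning = do
    halts? ← ¬¬-excluded-middle
    return (model halts?)
    where
      model : Dec (∃ λ n → f (play n) ≡ nothing) → ∃ λ w → Models w φ
      model (yes (n , stop)) = fin (play n) , winning (fin (play n)) (play-compatible n) stop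
      model (no endless) = let open Endless move in inf run , winning (inf run) run-compatible run-fair
        where
          move : ∀ n → ∃ λ σ → f (play n) ≡ just σ
          move n with f (play n) in next
          ... | just σ = σ , refl
          ... | nothing = ⊥-elim (endless (n , next))

module Replay (ns ne ks : ℕ) where
  open Exec ns ne ks 0 0

  replay : List Event → Strategy
  replay [] _ = nothing
  replay (x ∷ l) [] = toSys x
  replay (x ∷ l) (_ ∷ u) = replay l u

  replay-exhausted : ∀ l u → length l ≤ length u → replay l u ≡ nothing
  replay-exhausted [] u _ = refl
  replay-exhausted (x ∷ l) (_ ∷ u) (s≤s l≤u) = replay-exhausted l u l≤u

  system : ∀ x → ∃ λ σ → toSys x ≡ just σ
  system (sev a p) = (a , p) , refl
  system (eev a (inj₁ ()))
  system (eev a (inj₂ ()))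

  toSys-injective : ∀ {x y σ} → toSys x ≡ just σ → toSys y ≡ just σ → x ≡ y
  toSys-injective {sev a p} {sev a′ p′} refl refl = refl

  replay-only : ∀ l′ l → Compatible (replay l) (fin l′) → Fair (replay l) (fin l′) → l′ ≡ l
  replay-only [] [] _ _ = refl
  replay-only [] (x ∷ l) _ stop with () ← trans (sym (proj₂ (system x))) stop
  replay-only (y ∷ u) [] compatible _ with () ← compatible zero _ (proj₂ (system y))
  replay-only (y ∷ u) (x ∷ l) compatible stop =
    cong₂ _∷_ (toSys-injective (proj₂ (system y)) (compatible zero _ (proj₂ (system y))))
              (replay-only u l (compatible ∘ suc) stop)

  length-infPrefix : ∀ g n → length (infPrefix g n) ≡ n
  length-infPrefix g n = trans (Listₚ.length-map g (List.upTo n)) (Listₚ.length-upTo n)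

  replay-winning : ∀ l (φ : Sentence ns ne) → Models (fin l) φ → Winning (replay l) φ
  replay-winning l φ model (fin l′) compatible stop =
    subst (λ l″ → Models (fin l″) φ) (sym (replay-only l′ l compatible stop)) model
  replay-winning l φ model (inf g) compatible _
    with () ← trans (sym (compatible (length l) _ (proj₂ (system (g (length l))))))
                    (replay-exhausted l (infPrefix g (length l))
                       (ℕₚ.≤-reflexive (sym (length-infPrefix g (length l)))))

module Decidability (ns ne : ℕ) (φ : Sentence ns ne) where
  open module Ex ks = Executions ns ne ks 0 0 using (SmallModel; small-model?; small-model; finite-Event)

  K : ℕ
  K = rank φ

  -- K processes per profile, then K occurrences per event.
  process-bound : ℕ
  process-bound = size (finite-Vec ns (finite-Fin {suc K})) * K

  position-bound : ℕ → ℕ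
  position-bound ks = size (finite-Event ks) * K

  Witness : Set
  Witness = ∃ λ ks → ks < suc process-bound × SmallModel ks (position-bound ks) φ

  witness? : Dec Witness
  witness? = ℕₚ.anyUpTo? (λ ks → small-model? ks (position-bound ks) φ) (suc process-bound)

  witness-sat : Witness → SatProblem ns ne φ
  witness-sat (ks , _ , l , _ , model) = ks , Replay.replay ns ne ks l , Replay.replay-winning ns ne ks l φ model

  sat-witness : SatProblem ns ne φ → ¬¬ Witness
  sat-witness (ks , f , winning) = do
    w , model ← Runs.strategy-model ns ne ks 0 0 f φ winning
    c , c≤K , sat₁ ← Ex.PositionReduction.reduce-positions ks (Ex.positions ks w) K φ ℕₚ.≤-refl
                       (to (Ex.Models⇔⊨ ks w φ) model)
    ks′ , ks′≤ , c′ , c′≤K , sat₂ ← ProcessReduction.reduce-processes ns ne 0 0 c c≤K φ ℕₚ.≤-refl sat₁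
    return (ks′ , s≤s ks′≤ , small-model ks′ c′ φ c′≤K sat₂)

  sat? : Dec (SatProblem ns ne φ)
  sat? = map′ witness-sat (decidable-stable witness? ∘ sat-witness) witness?

corollary1 : ((ns ne : ℕ) (φ : Sentence ns ne) → Dec (SatProblem ns ne φ))
    × ((ns ne ks ke kse : ℕ) (φ : Sentence ns ne) (g : ℕ → Exec.Event ns ne ks ke kse)
       → Exec.Models ns ne ks ke kse (Exec.inf g) φ
       → Σ ℕ λ ks' → Σ ℕ λ ke' → Σ ℕ λ kse' → Σ (List (Exec.Event ns ne ks' ke' kse')) λ l
       → Exec.Models ns ne ks' ke' kse' (Exec.fin l) φ)
corollary1 = (λ ns ne φ → Decidability.sat? ns ne φ)
           , λ ns ne ks ke kse φ g model → ks , ke , kse , Executions.finite-model ns ne ks ke kse g φ model
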